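{- If $v \ge 6$, then the localization number of the incidence graph of any Steiner system $S(3,4,v)$ is at most $v - 3$.
   Context: A Steiner system $S(t,k,v)$ with $2 \le t < k < v$ is a set $X$ of $v$ points with a collection of $k$-element subsets (blocks) such that every $t$-subset of $X$ lies in exactly one block; $S(3,4,v)$ is a Steiner quadruple system. Its incidence graph is the bipartite graph on points and blocks with $x \sim B$ iff $x \in B$. Localization game on a connected graph $G$ with $k$ cops: the robber chooses a starting vertex, invisible to the cops. Each round the cops choose any $k$ vertices (no adjacency restriction) and each learns its distance to the robber; the cops win if after finitely many rounds they determine the robber's vertex uniquely; otherwise the robber moves to a neighbour or stays. The robber knows the cops' strategy. The localization number $\zeta(G)$ is the least $k$ for which $k$ cops can guarantee capture. -}

module Defs where

open import Data.Nat using (ℕ; zero; suc; _<_; _≤_)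
open import Data.Fin using (Fin)
open import Data.Fin.Subset using (Subset; _∈_; _⊆_; ∣_∣)
open import Data.Vec using (Vec; lookup)
open import Data.Product using (∃; ∃!; _×_; _,_)
open import Data.Sum using (_⊎_; inj₁; inj₂)
open import Data.Empty using (⊥)
open import Data.Unit using (⊤)
open import Relation.Nullary using (¬_)
open import Relation.Binary.PropositionalEquality using (_≡_)

record SteinerSystem (t k v : ℕ) : Set where
  field
    two≤t  : 2 ≤ t
    t<k    : t < k
    k<v    : k < v
    b      : ℕ
    blocks : Fin b → Subset v
    blockSize : ∀ B → ∣ blocks B ∣ ≡ k
    steiner   : ∀ (T : Subset v) → ∣ T ∣ ≡ t → ∃! _≡_ (λ B → T ⊆ blocks B)

module _ {t k v : ℕ} (S : SteinerSystem t k v) where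
  open SteinerSystem S

  IncVertex : Set
  IncVertex = Fin v ⊎ Fin b

  IncAdj : IncVertex → IncVertex → Set
  IncAdj (inj₁ x) (inj₂ B) = x ∈ blocks B
  IncAdj (inj₂ B) (inj₁ x) = x ∈ blocks B
  IncAdj (inj₁ _) (inj₁ _) = ⊥
  IncAdj (inj₂ _) (inj₂ _) = ⊥

module _ {V : Set} (Adj : V → V → Set) where

  data Walk : V → V → ℕ → Set where
    here : ∀ {u} → Walk u u 0
    step : ∀ {u w z n} → Adj u w → Walk w z n → Walk u z (suc n)

  IsDist : V → V → ℕ → Set
  IsDist u w n = Walk u w n × (∀ m → m < n → ¬ Walk u w m)

  SameDist : V → V → V → Set
  SameDist p x r = ∀ n → (IsDist p x n → IsDist p r n) × (IsDist p r n → IsDist p x n)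

  Indist : ∀ {k} → Vec V k → (V → Set) → V → V → Set
  Indist P S r x = S x × (∀ i → SameDist (lookup P i) x r)

  -- closed neighbourhood of a set of vertices (robber moves or stays)
  ClosedNbhd : (V → Set) → V → Set
  ClosedNbhd C y = ∃ λ x → C x × (x ≡ y ⊎ Adj x y)

  -- CopsWin k S : k cops can guarantee to locate a robber known only to
  -- be somewhere in S, in finitely many rounds.  Each round the cops
  -- probe k vertices P; for each possible robber vertex r, either the
  -- observed distances determine r uniquely, or the robber moves and
  -- the cops must win from the closed neighbourhood of the set of
  -- candidates consistent with the observation.
  data CopsWin (k : ℕ) : (V → Set) → Set₁ where
    win : ∀ {S : V → Set} (P : Vec V k) →
          (∀ r → S r → (∀ x → Indist P S r x → x ≡ r)
                      ⊎ CopsWin k (ClosedNbhd (Indist P S r))) →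
          CopsWin k S

  LocNumberAtMost : ℕ → Set₁
  LocNumberAtMost m = ∃ λ k → k ≤ m × CopsWin k (λ _ → ⊤)

-- Probe every point outside a 3-set T.  A block B has a probed point q outside T,
-- so anything indistinguishable from B is a block C through q; B and C then agree
-- outside T, hence share at least 3 points, hence coincide.  A point robber is never
-- confused with a block, and only with another unprobed point.  With T = {0,1,2}
-- the cops locate everything except a point robber in {0,1,2}; after he moves he is
-- on such a point or on a block, and a second round with T = {2,3,4} locates him,
-- since 2 is the only point left unprobed in both rounds.
module Submission where

open import Defs
open import Data.Bool using (true; false)
open import Data.Empty using (⊥-elim)
open import Data.Fin using (Fin; zero; suc)
open import Data.Fin.Subset using (Subset; _∈_; _∉_; _⊆_; ∣_∣; _∩_; _∪_; ⊥)
open import Data.Fin.Subset.Properties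
  using (∉⊥; ∣⊥∣≡0; drop-there; x∈p∪q⁺; p∩q⊆p; p∩q⊆q; _∈?_)
open import Data.Nat using (ℕ; zero; suc; _+_; _<_; _≤_; _∸_; z≤n; s≤s)
open import Data.Nat.Properties
  using (+-suc; +-assoc; +-comm; +-cancelˡ-≤; +-monoˡ-≤; +-monoʳ-≤; ≤-trans; ≤-refl; n≤1+n; module ≤-Reasoning)
open import Data.Product using (∃; _×_; _,_; proj₁; proj₂; swap)
open import Data.Sum using (_⊎_; inj₁; inj₂)
open import Data.Unit using (⊤; tt)
open import Data.Vec using (Vec; []; _∷_; lookup; tabulate)
open import Data.Vec.Base using (here; there)
open import Data.Vec.Properties using (lookup∘tabulate)
open import Relation.Nullary using (yes; no)
open import Relation.Binary.PropositionalEquality using (_≡_; refl; sym; trans; cong; subst; subst₂)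

m+m≤1+n+n⇒m≤n : ∀ m n → m + m ≤ suc (n + n) → m ≤ n
m+m≤1+n+n⇒m≤n zero n _ = z≤n
m+m≤1+n+n⇒m≤n (suc m) zero (s≤s h) rewrite +-suc m m with h
... | ()
m+m≤1+n+n⇒m≤n (suc m) (suc n) (s≤s h) rewrite +-suc m m | +-suc n n with h
... | s≤s h′ = s≤s (m+m≤1+n+n⇒m≤n m n h′)

∣q∣<∣p∣⇒∃∈p∉q : ∀ {n} (p q : Subset n) → ∣ q ∣ < ∣ p ∣ → ∃ λ x → x ∈ p × x ∉ q
∣q∣<∣p∣⇒∃∈p∉q (true ∷ p) (false ∷ q) _ = zero , here , λ ()
∣q∣<∣p∣⇒∃∈p∉q (true ∷ p) (true ∷ q) (s≤s lt) with ∣q∣<∣p∣⇒∃∈p∉q p q lt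
... | x , x∈p , x∉q = suc x , there x∈p , λ x∈q → x∉q (drop-there x∈q)
∣q∣<∣p∣⇒∃∈p∉q (false ∷ p) (true ∷ q) lt with ∣q∣<∣p∣⇒∃∈p∉q p q (≤-trans (n≤1+n _) lt)
... | x , x∈p , x∉q = suc x , there x∈p , λ x∈q → x∉q (drop-there x∈q)
∣q∣<∣p∣⇒∃∈p∉q (false ∷ p) (false ∷ q) lt with ∣q∣<∣p∣⇒∃∈p∉q p q lt
... | x , x∈p , x∉q = suc x , there x∈p , λ x∈q → x∉q (drop-there x∈q)

k≤∣p∣⇒∃q⊆p : ∀ {n} (p : Subset n) k → k ≤ ∣ p ∣ → ∃ λ q → q ⊆ p × ∣ q ∣ ≡ k
k≤∣p∣⇒∃q⊆p {n} p zero _ = ⊥ , (λ x∈⊥ → ⊥-elim (∉⊥ x∈⊥)) , ∣⊥∣≡0 n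
k≤∣p∣⇒∃q⊆p (true ∷ p) (suc k) (s≤s k≤∣p∣) with k≤∣p∣⇒∃q⊆p p k k≤∣p∣
... | q , q⊆p , ∣q∣≡k =
  true ∷ q , (λ { here → here ; (there x∈q) → there (q⊆p x∈q) }) , cong suc ∣q∣≡k
k≤∣p∣⇒∃q⊆p (false ∷ p) (suc k) k<∣p∣ with k≤∣p∣⇒∃q⊆p p (suc k) k<∣p∣
... | q , q⊆p , ∣q∣≡k = false ∷ q , (λ { (there x∈q) → there (q⊆p x∈q) }) , ∣q∣≡k

-- p ∖ q and q ∖ p are disjoint subsets of t.
∣p∣+∣q∣≤∣p∩q∣+∣p∩q∣+∣t∣ : ∀ {n} (p q t : Subset n) → p ⊆ q ∪ t → q ⊆ p ∪ t →
                           ∣ p ∣ + ∣ q ∣ ≤ ∣ p ∩ q ∣ + ∣ p ∩ q ∣ + ∣ t ∣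
∣p∣+∣q∣≤∣p∩q∣+∣p∩q∣+∣t∣ [] [] [] _ _ = z≤n
∣p∣+∣q∣≤∣p∩q∣+∣p∩q∣+∣t∣ (x ∷ p) (y ∷ q) (z ∷ t) p⊆q∪t q⊆p∪t =
  heads x y z p⊆q∪t q⊆p∪t
    (∣p∣+∣q∣≤∣p∩q∣+∣p∩q∣+∣t∣ p q t (λ i∈p → drop-there (p⊆q∪t (there i∈p)))
                                   (λ i∈q → drop-there (q⊆p∪t (there i∈q))))
  where
  P = ∣ p ∣ ; Q = ∣ q ∣ ; I = ∣ p ∩ q ∣ ; T = ∣ t ∣
  heads : ∀ x y z → x ∷ p ⊆ (y ∷ q) ∪ (z ∷ t) → y ∷ q ⊆ (x ∷ p) ∪ (z ∷ t) →
          P + Q ≤ I + I + T →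
          ∣ x ∷ p ∣ + ∣ y ∷ q ∣ ≤ ∣ (x ∷ p) ∩ (y ∷ q) ∣ + ∣ (x ∷ p) ∩ (y ∷ q) ∣ + ∣ z ∷ t ∣
  heads true true false _ _ h rewrite +-suc P Q | +-suc I I = s≤s (s≤s h)
  heads true true true _ _ h rewrite +-suc P Q | +-suc I I | +-suc (I + I) T =
    s≤s (s≤s (≤-trans h (n≤1+n _)))
  heads true false true _ _ h rewrite +-suc (I + I) T = s≤s h
  heads false true true _ _ h rewrite +-suc P Q | +-suc (I + I) T = s≤s h
  heads false false true _ _ h rewrite +-suc (I + I) T = ≤-trans h (n≤1+n _)
  heads false false false _ _ h = h
  heads true false false p₀⊆ _ _ with p₀⊆ here
  ... | ()
  heads false true false _ q₀⊆ _ with q₀⊆ here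
  ... | ()

module _ {V : Set} {Adj : V → V → Set} where

  Walk-0⇒≡ : ∀ {u w} → Walk Adj u w 0 → u ≡ w
  Walk-0⇒≡ here = refl

  IsDist-refl : ∀ u → IsDist Adj u u 0
  IsDist-refl u = here , λ _ ()

  SameDist-sym : ∀ {p x r} → SameDist Adj p x r → SameDist Adj p r x
  SameDist-sym same n = swap (same n)

  CopsWin-⊆ : ∀ {k} {C C′ : V → Set} → CopsWin Adj k C → (∀ x → C′ x → C x) → CopsWin Adj k C′
  CopsWin-⊆ {C = C} {C′} (win P strategy) C′⊆C = win P outcome
    where
    outcome : ∀ r → C′ r → _
    outcome r r∈C′ with strategy r (C′⊆C r r∈C′)
    ... | inj₁ located = inj₁ λ x (x∈C′ , same) → located x (C′⊆C x x∈C′ , same)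
    ... | inj₂ next = inj₂ (CopsWin-⊆ next λ { y (x , (x∈C′ , same) , x∼y) → x , (C′⊆C x x∈C′ , same) , x∼y })

  module _ {k} {P : Vec V k} {C : V → Set} {r x : V} where

    probe-at-robber : ∀ i → lookup P i ≡ r → Indist Adj P C r x → x ≡ r
    probe-at-robber i refl (_ , same) = sym (Walk-0⇒≡ (proj₁ (proj₂ (same i 0) (IsDist-refl _))))

    probe-at-candidate : ∀ i → lookup P i ≡ x → Indist Adj P C r x → x ≡ r
    probe-at-candidate i refl (_ , same) = Walk-0⇒≡ (proj₁ (proj₁ (same i 0) (IsDist-refl _)))

module _ {t k v} (S : SteinerSystem t k v) where
  open SteinerSystem S

  ≥t-common-points⇒≡ : ∀ B C → t ≤ ∣ blocks B ∩ blocks C ∣ → B ≡ C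
  ≥t-common-points⇒≡ B C t≤∣B∩C∣ with k≤∣p∣⇒∃q⊆p (blocks B ∩ blocks C) t t≤∣B∩C∣
  ... | X , X⊆B∩C , ∣X∣≡t with steiner X ∣X∣≡t
  ...   | _ , _ , unique = trans (sym (unique (λ x∈X → p∩q⊆p _ _ (X⊆B∩C x∈X))))
                                 (unique (λ x∈X → p∩q⊆q _ _ (X⊆B∩C x∈X)))

  agree-off-small-set⇒≡ : ∀ {T : Subset v} → ∣ T ∣ + (t + t) ≤ suc (k + k) → ∀ B C →
                          blocks B ⊆ blocks C ∪ T → blocks C ⊆ blocks B ∪ T → B ≡ C
  agree-off-small-set⇒≡ {T} small B C B⊆C∪T C⊆B∪T =
    ≥t-common-points⇒≡ B C (m+m≤1+n+n⇒m≤n t I (+-cancelˡ-≤ (k + k) (t + t) (suc J) bound))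
    where
    I = ∣ blocks B ∩ blocks C ∣
    J = I + I
    size-bound : k + k ≤ J + ∣ T ∣
    size-bound = subst₂ (λ ∣B∣ ∣C∣ → ∣B∣ + ∣C∣ ≤ J + ∣ T ∣) (blockSize B) (blockSize C)
                        (∣p∣+∣q∣≤∣p∩q∣+∣p∩q∣+∣t∣ (blocks B) (blocks C) T B⊆C∪T C⊆B∪T)
    open ≤-Reasoning
    bound : k + k + (t + t) ≤ k + k + suc J
    bound = begin
      k + k + (t + t)      ≤⟨ +-monoˡ-≤ (t + t) size-bound ⟩
      J + ∣ T ∣ + (t + t)  ≡⟨ +-assoc J ∣ T ∣ (t + t) ⟩
      J + (∣ T ∣ + (t + t)) ≤⟨ +-monoʳ-≤ J small ⟩
      J + suc (k + k)      ≡⟨ +-suc J (k + k) ⟩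
      suc (J + (k + k))    ≡⟨ cong suc (+-comm J (k + k)) ⟩
      suc (k + k + J)      ≡⟨ +-suc (k + k) J ⟨
      k + k + suc J        ∎

  point∉-in-block : ∀ {T : Subset v} → ∣ T ∣ < k → ∀ B → ∃ λ q → q ∈ blocks B × q ∉ T
  point∉-in-block {T} ∣T∣<k B = ∣q∣<∣p∣⇒∃∈p∉q (blocks B) T (subst (∣ T ∣ <_) (sym (blockSize B)) ∣T∣<k)

  Walk-1-from-point : ∀ {q y} → Walk (IncAdj S) (inj₁ q) y 1 → ∃ λ C → y ≡ inj₂ C × q ∈ blocks C
  Walk-1-from-point {y = inj₂ C} (step q∈C here) = C , refl , q∈C
  Walk-1-from-point {y = inj₁ _} (step {w = inj₁ _} () here)

  SameDist-point-block : ∀ {q B y} → SameDist (IncAdj S) (inj₁ q) (inj₂ B) y → q ∈ blocks B →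
                         ∃ λ C → y ≡ inj₂ C × q ∈ blocks C
  SameDist-point-block same q∈B = Walk-1-from-point (proj₁ (proj₁ (same 1) dist-1))
    where
    dist-1 = step q∈B here , λ { zero _ () ; (suc _) (s≤s ()) }

  SameDist-off⇒⊆∪ : ∀ {T : Subset v} {D E} →
                    (∀ {q} → q ∉ T → SameDist (IncAdj S) (inj₁ q) (inj₂ D) (inj₂ E)) →
                    blocks D ⊆ blocks E ∪ T
  SameDist-off⇒⊆∪ {T} same {x} x∈D with x ∈? T
  ... | yes x∈T = x∈p∪q⁺ (inj₂ x∈T)
  ... | no x∉T with SameDist-point-block (same x∉T) x∈D
  ...   | _ , refl , x∈E = x∈p∪q⁺ (inj₁ x∈E)

  module Probing {c} (P : Vec (IncVertex S) c) (T : Subset v) (∣T∣<k : ∣ T ∣ < k)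
                 (probed : ∀ q → q ∉ T → ∃ λ i → lookup P i ≡ inj₁ q) {C : IncVertex S → Set} where

    Indist′ : IncVertex S → IncVertex S → Set
    Indist′ = Indist (IncAdj S) P C

    SameDist-unprobed : ∀ {r x q} → Indist′ r x → q ∉ T → SameDist (IncAdj S) (inj₁ q) x r
    SameDist-unprobed {r} {x} (_ , same) q∉T with probed _ q∉T
    ... | i , probe≡q = subst (λ p → SameDist (IncAdj S) p x r) probe≡q (same i)

    block-located : ∣ T ∣ + (t + t) ≤ suc (k + k) → ∀ {B x} → Indist′ (inj₂ B) x → x ≡ inj₂ B
    block-located small {B} ind with point∉-in-block ∣T∣<k B
    ... | q , q∈B , q∉T with SameDist-point-block (SameDist-sym (SameDist-unprobed ind q∉T)) q∈B
    ...   | C , refl , _ = cong inj₂ (sym (agree-off-small-set⇒≡ small B C B⊆C∪T C⊆B∪T))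
      where
      B⊆C∪T = SameDist-off⇒⊆∪ (λ q∉T → SameDist-sym (SameDist-unprobed ind q∉T))
      C⊆B∪T = SameDist-off⇒⊆∪ (SameDist-unprobed ind)

    point-candidate : ∀ {y x} → Indist′ (inj₁ y) x → ∃ λ z → x ≡ inj₁ z × (z ≡ y ⊎ z ∈ T × y ∈ T)
    point-candidate {x = inj₂ D} ind with point∉-in-block ∣T∣<k D
    ... | q , q∈D , q∉T with SameDist-point-block (SameDist-unprobed ind q∉T) q∈D
    ...   | _ , () , _
    point-candidate {y} {inj₁ z} ind with z ∈? T | y ∈? T
    ... | no z∉T | _ with probed z z∉T
    ...   | i , probe≡z with probe-at-candidate {P = P} {C = C} i probe≡z ind
    ...     | refl = z , refl , inj₁ refl
    point-candidate {y} {inj₁ z} ind | yes _ | no y∉T with probed y y∉T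
    ...   | i , probe≡y with probe-at-robber {P = P} {C = C} i probe≡y ind
    ...     | refl = z , refl , inj₁ refl
    point-candidate {y} {inj₁ z} ind | yes z∈T | yes y∈T = z , refl , inj₂ (z∈T , y∈T)

module TwoRounds (m : ℕ) (S : SteinerSystem 3 4 (6 + m)) where

  T₁ T₂ : Subset (6 + m)
  T₁ = true ∷ true ∷ true ∷ ⊥
  T₂ = false ∷ false ∷ true ∷ true ∷ true ∷ ⊥

  T₁∩T₂ : ∀ {z} → z ∈ T₁ → z ∈ T₂ → z ≡ suc (suc zero)
  T₁∩T₂ here ()
  T₁∩T₂ (there here) (there ())
  T₁∩T₂ (there (there here)) _ = refl
  T₁∩T₂ (there (there (there z∈⊥))) _ = ⊥-elim (∉⊥ z∈⊥)

  probe₁ probe₂ : Fin (3 + m) → IncVertex S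
  probe₁ j = inj₁ (suc (suc (suc j)))
  probe₂ zero = inj₁ zero
  probe₂ (suc zero) = inj₁ (suc zero)
  probe₂ (suc (suc j)) = inj₁ (suc (suc (suc (suc (suc j)))))

  P₁ P₂ : Vec (IncVertex S) (3 + m)
  P₁ = tabulate probe₁
  P₂ = tabulate probe₂

  probed₁ : ∀ q → q ∉ T₁ → ∃ λ i → lookup P₁ i ≡ inj₁ q
  probed₁ zero q∉T₁ = ⊥-elim (q∉T₁ here)
  probed₁ (suc zero) q∉T₁ = ⊥-elim (q∉T₁ (there here))
  probed₁ (suc (suc zero)) q∉T₁ = ⊥-elim (q∉T₁ (there (there here)))
  probed₁ (suc (suc (suc j))) _ = j , lookup∘tabulate probe₁ j

  probed₂ : ∀ q → q ∉ T₂ → ∃ λ i → lookup P₂ i ≡ inj₁ q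
  probed₂ zero _ = zero , refl
  probed₂ (suc zero) _ = suc zero , refl
  probed₂ (suc (suc zero)) q∉T₂ = ⊥-elim (q∉T₂ (there (there here)))
  probed₂ (suc (suc (suc zero))) q∉T₂ = ⊥-elim (q∉T₂ (there (there (there here))))
  probed₂ (suc (suc (suc (suc zero)))) q∉T₂ = ⊥-elim (q∉T₂ (there (there (there (there here)))))
  probed₂ (suc (suc (suc (suc (suc j))))) _ = suc (suc j) , lookup∘tabulate probe₂ (suc (suc j))

  ProbingBounds : Subset (6 + m) → Set
  ProbingBounds T = ∣ T ∣ < 4 × ∣ T ∣ + (3 + 3) ≤ suc (4 + 4)

  ∣T∣≡3⇒ProbingBounds : ∀ T → ∣ T ∣ ≡ 3 → ProbingBounds T
  ∣T∣≡3⇒ProbingBounds T ∣T∣≡3 rewrite ∣T∣≡3 = ≤-refl , ≤-refl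

  few₁ : ProbingBounds T₁
  few₁ = ∣T∣≡3⇒ProbingBounds T₁ (cong (3 +_) (∣⊥∣≡0 (3 + m)))

  few₂ : ProbingBounds T₂
  few₂ = ∣T∣≡3⇒ProbingBounds T₂ (cong (3 +_) (∣⊥∣≡0 (1 + m)))

  module Round₁ {C} = Probing S P₁ T₁ (proj₁ few₁) probed₁ {C}
  module Round₂ {C} = Probing S P₂ T₂ (proj₁ few₂) probed₂ {C}

  OnT₁OrBlock : IncVertex S → Set
  OnT₁OrBlock (inj₁ z) = z ∈ T₁
  OnT₁OrBlock (inj₂ _) = ⊤

  second-round : CopsWin (IncAdj S) (3 + m) OnT₁OrBlock
  second-round = win P₂ outcome
    where
    point-located : ∀ {y x} → y ∈ T₁ → Indist (IncAdj S) P₂ OnT₁OrBlock (inj₁ y) x → x ≡ inj₁ y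
    point-located y∈T₁ ind with Round₂.point-candidate {OnT₁OrBlock} ind
    ... | _ , refl , inj₁ refl = refl
    ... | _ , refl , inj₂ (z∈T₂ , y∈T₂) =
      cong inj₁ (trans (T₁∩T₂ (proj₁ ind) z∈T₂) (sym (T₁∩T₂ y∈T₁ y∈T₂)))
    outcome : ∀ r → OnT₁OrBlock r → _
    outcome (inj₂ B) _ = inj₁ λ _ → Round₂.block-located {OnT₁OrBlock} (proj₂ few₂)
    outcome (inj₁ y) y∈T₁ = inj₁ λ _ → point-located y∈T₁

  first-round : CopsWin (IncAdj S) (3 + m) (λ _ → ⊤)
  first-round = win P₁ outcome
    where
    moved-into : ∀ {y} → y ∈ T₁ → ∀ w →
                 ClosedNbhd (IncAdj S) (Indist (IncAdj S) P₁ (λ _ → ⊤) (inj₁ y)) w → OnT₁OrBlock w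
    moved-into _ (inj₂ _) _ = tt
    moved-into y∈T₁ (inj₁ _) (_ , ind , stayed) with Round₁.point-candidate {λ _ → ⊤} ind | stayed
    ... | _ , refl , inj₁ refl | inj₁ refl = y∈T₁
    ... | _ , refl , inj₂ (z∈T₁ , _) | inj₁ refl = z∈T₁
    ... | _ , refl , _ | inj₂ ()
    outcome : ∀ r → ⊤ → _
    outcome (inj₂ B) _ = inj₁ λ _ → Round₁.block-located {λ _ → ⊤} (proj₂ few₁)
    outcome (inj₁ y) _ with y ∈? T₁
    ... | yes y∈T₁ = inj₂ (CopsWin-⊆ second-round (moved-into y∈T₁))
    ... | no y∉T₁ with probed₁ y y∉T₁
    ...   | i , probe≡y = inj₁ λ _ → probe-at-robber {P = P₁} {C = λ _ → ⊤} i probe≡y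

theorem4p4 : ∀ (v : ℕ) → 6 ≤ v → (S : SteinerSystem 3 4 v) →
    LocNumberAtMost (IncAdj S) (v ∸ 3)
theorem4p4 (suc (suc (suc (suc (suc (suc m)))))) (s≤s (s≤s (s≤s (s≤s (s≤s (s≤s _)))))) S =
  3 + m , ≤-refl , TwoRounds.first-round m S
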